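{- Let $\mathcal{A}$ be a real central hyperplane arrangement with fundamental chamber $c_0$, and let $H_1,H_2,\dots,H_N$ be an admissible permutation of $\mathcal{A}$. Suppose that for some codimension 2 intersection subspace $X$, the set of hyperplanes of $\mathcal{A}$ containing $X$ is exactly a contiguous subsequence $H_i,H_{i+1},\dots,H_j$. Then the permutation $H_1,\dots,H_{i-1},H_j,H_{j-1},\dots,H_i,H_{j+1},\dots,H_N$ is also an admissible permutation of $\mathcal{A}$.
   Context: $\mathcal{A}$ is a finite set of linear hyperplanes in $\mathbb{R}^n$; chambers are the connected components of the complement of their union and $-c$ denotes the opposite chamber. For a codimension 2 intersection subspace $X$, $\mathcal{A}_X=\{H\in\mathcal{A}:H\supseteq X\}$, a rank 2 arrangement, and $(c_0)_X$ is the chamber of $\mathcal{A}_X$ containing $c_0$. A reduced gallery of $\mathcal{A}_X$ from $(c_0)_X$ to $-(c_0)_X$ is a sequence of chambers of $\mathcal{A}_X$ from $(c_0)_X$ to $-(c_0)_X$ in which consecutive chambers are separated by exactly one hyperplane and each hyperplane of $\mathcal{A}_X$ is crossed exactly once; it induces the order in which the hyperplanes are crossed. A permutation of $\mathcal{A}$ is admissible if for every codimension 2 intersection subspace $X$, its restriction to $\mathcal{A}_X$ is the order induced by some reduced gallery of $\mathcal{A}_X$ from $(c_0)_X$ to $-(c_0)_X$. -}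

module Defs where

open import Level using (Level; _⊔_) renaming (suc to lsuc)
open import Data.Nat using (ℕ; zero; suc)
import Data.Nat
open import Data.Fin using (Fin; zero; suc)
open import Data.Product using (Σ; ∃; _×_; _,_)
open import Data.Sum using (_⊎_)
open import Data.List using (List; []; _∷_; take; length)
open import Data.List.Membership.Propositional using (_∈_; _∉_)
open import Data.List.Relation.Unary.All using (All)
open import Data.List.Relation.Unary.Unique.Propositional using (Unique)
open import Relation.Nullary using (¬_)
open import Relation.Binary.PropositionalEquality using (_≡_; _≢_)
open import Relation.Binary.Structures using (IsStrictTotalOrder)
open import Algebra.Bundles using (CommutativeRing)
open import Function.Bundles using (_⇔_)

-- The real numbers: a complete ordered field (any model; all are
-- isomorphic).  No real numbers exist in agda-stdlib, so the statement
-- quantifies over an arbitrary model of this axiomatisation.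

record RealField (c ℓ : Level) : Set (lsuc (c ⊔ ℓ)) where
  field
    commRing : CommutativeRing c ℓ
  open CommutativeRing commRing public using (Carrier; _≈_; _+_; _*_; -_; 0#; 1#)
  field
    _<_ : Carrier → Carrier → Set ℓ
    <-isStrictTotalOrder : IsStrictTotalOrder _≈_ _<_
    +-mono-< : ∀ {x y} z → x < y → (x + z) < (y + z)
    *-pos : ∀ {x y} → 0# < x → 0# < y → 0# < (x * y)
    0<1 : 0# < 1#
    inverse : ∀ x → ¬ (x ≈ 0#) → ∃ λ y → (x * y) ≈ 1#
  _≤_ : Carrier → Carrier → Set ℓ
  x ≤ y = (x < y) ⊎ (x ≈ y)
  field
    complete : (S : Carrier → Set ℓ) → ∃ S → (∃ λ b → ∀ x → S x → x ≤ b) →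
               ∃ λ s → (∀ x → S x → x ≤ s) × (∀ b → (∀ x → S x → x ≤ b) → s ≤ b)

module Arrangement {c ℓ} (R : RealField c ℓ) where
  open RealField R using (Carrier; _≈_; _+_; _*_; 0#; _<_)

  Vec : ℕ → Set c
  Vec n = Fin n → Carrier

  dot : ∀ {n} → Vec n → Vec n → Carrier
  dot {zero}  u v = 0#
  dot {suc n} u v = (u zero * v zero) + dot (λ i → u (suc i)) (λ i → v (suc i))

  OnHyp : ∀ {n} → Vec n → Vec n → Set ℓ
  OnHyp u x = dot u x ≈ 0#

  record CentralArrangement (n N : ℕ) : Set (c ⊔ ℓ) where
    field
      α : Fin N → Vec n
      nonzero : ∀ k → ∃ λ x → ¬ OnHyp (α k) x
      distinct : ∀ k l → k ≢ l → ¬ (∀ x → OnHyp (α k) x ⇔ OnHyp (α l) x)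

  module _ {n N : ℕ} (𝒜 : CentralArrangement n N) where
    open CentralArrangement 𝒜

    -- codimension 2 intersection subspaces are X = H_a ∩ H_b with a ≢ b;
    -- Contains a b k  means  H_k ⊇ H_a ∩ H_b, i.e. H_k ∈ 𝒜_X
    Contains : Fin N → Fin N → Fin N → Set (c ⊔ ℓ)
    Contains a b k = ∀ x → OnHyp (α a) x → OnHyp (α b) x → OnHyp (α k) x

    SameSide : Fin N → Vec n → Vec n → Set ℓ
    SameSide k x y = ((0# < dot (α k) x) × (0# < dot (α k) y))
                   ⊎ ((dot (α k) x < 0#) × (dot (α k) y < 0#))

    OppSide : Fin N → Vec n → Vec n → Set ℓ
    OppSide k x y = ((0# < dot (α k) x) × (dot (α k) y < 0#))
                  ⊎ ((dot (α k) x < 0#) × (0# < dot (α k) y))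

    -- fundamental chamber c₀, given by a point p₀ off all hyperplanes
    -- (c₀ is the chamber of 𝒜 containing p₀)
    Generic : Vec n → Set ℓ
    Generic p = ∀ k → (0# < dot (α k) p) ⊎ (dot (α k) p < 0#)

    -- The k-th chamber of the gallery of 𝒜_X (X = H_a ∩ H_b) that starts
    -- at (c₀)_X and crosses the hyperplanes in the order G: it is the
    -- chamber of 𝒜_X lying on the opposite side from c₀ exactly of the
    -- first k hyperplanes of G.
    GalleryChamberExists : Vec n → Fin N → Fin N → List (Fin N) → ℕ → Set (c ⊔ ℓ)
    GalleryChamberExists p₀ a b G k =
      ∃ λ x → ∀ h → Contains a b h →
        (h ∈ take k G → OppSide h x p₀) × (h ∉ take k G → SameSide h x p₀)

    -- G is the order induced by a reduced gallery of 𝒜_X from (c₀)_X to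
    -- -(c₀)_X: G lists every hyperplane of 𝒜_X exactly once, and all
    -- chambers C_0 = (c₀)_X, C_1, …, C_{|G|} = -(c₀)_X exist, where C_{k+1}
    -- is separated from C_k exactly by the hyperplane G_k.
    ReducedGalleryOrder : Vec n → Fin N → Fin N → List (Fin N) → Set (c ⊔ ℓ)
    ReducedGalleryOrder p₀ a b G =
      All (Contains a b) G × Unique G × (∀ h → Contains a b h → h ∈ G) ×
      (∀ k → k Data.Nat.≤ length G → GalleryChamberExists p₀ a b G k)

    data Restrict {p} (P : Fin N → Set p) : List (Fin N) → List (Fin N) → Set p where
      []   : Restrict P [] []
      keep : ∀ {x xs ys} → P x → Restrict P xs ys → Restrict P (x ∷ xs) (x ∷ ys)
      skip : ∀ {x xs ys} → ¬ P x → Restrict P xs ys → Restrict P (x ∷ xs) ys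

    Admissible : Vec n → List (Fin N) → Set (c ⊔ ℓ)
    Admissible p₀ L = ∀ a b → a ≢ b →
      ∃ λ G → Restrict (Contains a b) L G × ReducedGalleryOrder p₀ a b G

{-# OPTIONS --safe #-}
module Submission where

-- If two distinct hyperplanes H₁, H₂ both contain the codimension 2 spaces X and X′, then
-- X = H₁ ∩ H₂ = X′.  So for X′ ≠ X at most one hyperplane of the block H_i, …, H_j lies in
-- 𝒜_{X′}, and reversing the block does not change the order induced on 𝒜_{X′}; for X′ = X the
-- induced order is reversed, and the reverse of a reduced gallery from (c₀)_X to -(c₀)_X is
-- again one: its k-th chamber is the negative of the (|G| - k)-th chamber of the original.

open import Defs
open import Level using (Level)
open import Data.Nat using (ℕ)
import Data.Nat as ℕ
open import Data.Nat.Properties using (m∸[m∸n]≡n; m∸n≤m)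
open import Data.Fin using (Fin; zero)
open import Data.Product using (_×_; _,_; ∃; ∃₂; proj₁; proj₂)
open import Data.Sum using (_⊎_; inj₁; inj₂; fromInj₁)
open import Data.Empty using (⊥-elim)
open import Relation.Nullary using (¬_; yes; no)
open import Relation.Unary using (_⊆_; _∩_)
open import Function.Bundles using (_⇔_; mk⇔; Equivalence)
open import Algebra.Bundles using (CommutativeRing)
open import Tactic.RingSolver using (solve-∀)
open import Tactic.RingSolver.Core.AlmostCommutativeRing using (AlmostCommutativeRing; fromCommutativeRing)
open import Data.Maybe using (nothing)
open import Data.Vec.Functional using (tail)
open import Relation.Binary.Structures using (IsStrictTotalOrder)
open import Function using (_∘′_)
open import Data.List using (List; []; _∷_; _++_; reverse; allFin; take; drop; length)
open import Data.List.Properties using (take++drop≡id; reverse-++; length-reverse; length-drop; unfold-reverse; ++-identityʳ)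
open import Data.List.Membership.Propositional using (_∈_)
open import Data.List.Membership.Propositional.Properties using (∈-++⁻; ∈-++⁺ˡ; ∈-++⁺ʳ)
open import Data.List.Relation.Unary.Any using (here; there)
import Data.List.Relation.Unary.Any.Properties as Any
open import Data.List.Relation.Unary.All as All using (All; []; _∷_)
import Data.List.Relation.Unary.All.Properties as All
open import Data.List.Relation.Unary.AllPairs using ([]; _∷_)
open import Data.List.Relation.Unary.Unique.Propositional using (Unique)
open import Data.List.Relation.Unary.Unique.Propositional.Properties using (allFin⁺)
open import Data.List.Relation.Binary.Disjoint.Propositional using (Disjoint)
open import Data.List.Relation.Binary.Permutation.Propositional using (_↭_; ↭-sym; ↭-trans; ↭⇒↭ₛ)
open import Data.List.Relation.Binary.Permutation.Propositional.Properties using (↭-reverse; All-resp-↭; ++⁺ˡ; ++⁺ʳ)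
import Data.List.Relation.Binary.Permutation.Setoid.Properties as Permutationₛ using (Unique-resp-↭)
open import Relation.Binary.PropositionalEquality as ≡ using (_≡_; _≢_; refl; cong; subst; subst₂; module ≡-Reasoning)

module _ {a} {A : Set a} where

  Unique-++⁻ : ∀ (xs : List A) {ys} → Unique (xs ++ ys) → Unique xs × Unique ys × Disjoint xs ys
  Unique-++⁻ []       u        = [] , u , λ ()
  Unique-++⁻ (x ∷ xs) (x∉ ∷ u) with Unique-++⁻ xs u
  ... | uxs , uys , xs∩ys=∅ = All.++⁻ˡ xs x∉ ∷ uxs , uys , λ where
    (here refl , y∈ys) → All.lookup x∉ (∈-++⁺ʳ xs y∈ys) refl
    (there v∈xs , v∈ys) → xs∩ys=∅ (v∈xs , v∈ys)

  Unique-resp-↭ : ∀ {xs ys : List A} → xs ↭ ys → Unique xs → Unique ys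
  Unique-resp-↭ xs↭ys = Permutationₛ.Unique-resp-↭ (≡.setoid A) (↭⇒↭ₛ xs↭ys)

  Unique-middle : ∀ (xs : List A) {ys zs} → Unique (xs ++ ys ++ zs) → Unique ys
  Unique-middle xs u = proj₁ (Unique-++⁻ _ (proj₁ (proj₂ (Unique-++⁻ xs u))))

  take-++ : ∀ {k} (xs ys : List A) → length xs ≡ k → take k (xs ++ ys) ≡ xs
  take-++ []       ys refl = refl
  take-++ (x ∷ xs) ys refl = cong (x ∷_) (take-++ xs ys refl)

  take-reverse : ∀ {k} (xs : List A) → k ℕ.≤ length xs →
                 take k (reverse xs) ≡ reverse (drop (length xs ℕ.∸ k) xs)
  take-reverse {k} xs k≤∣xs∣ = begin
    take k (reverse xs)                                 ≡⟨ cong (take k ∘′ reverse) (take++drop≡id m xs) ⟨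
    take k (reverse (take m xs ++ drop m xs))           ≡⟨ cong (take k) (reverse-++ (take m xs) (drop m xs)) ⟩
    take k (reverse (drop m xs) ++ reverse (take m xs)) ≡⟨ take-++ _ _ ∣rev-drop∣≡k ⟩
    reverse (drop m xs)                                 ∎
    where
    open ≡-Reasoning
    m = length xs ℕ.∸ k
    ∣rev-drop∣≡k : length (reverse (drop m xs)) ≡ k
    ∣rev-drop∣≡k = begin
      length (reverse (drop m xs)) ≡⟨ length-reverse (drop m xs) ⟩
      length (drop m xs)           ≡⟨ length-drop m xs ⟩
      length xs ℕ.∸ m              ≡⟨ m∸[m∸n]≡n k≤∣xs∣ ⟩
      k                            ∎

  ∈-take⊎∈-take-reverse : ∀ {k x} (xs : List A) → k ℕ.≤ length xs → x ∈ xs →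
                          x ∈ take (length xs ℕ.∸ k) xs ⊎ x ∈ take k (reverse xs)
  ∈-take⊎∈-take-reverse {k} {x} xs k≤ x∈xs
    with ∈-++⁻ (take m xs) (subst (x ∈_) (≡.sym (take++drop≡id m xs)) x∈xs)
    where m = length xs ℕ.∸ k
  ... | inj₁ x∈take = inj₁ x∈take
  ... | inj₂ x∈drop = inj₂ (subst (x ∈_) (≡.sym (take-reverse xs k≤)) (Any.reverse⁺ x∈drop))

  take-reverse-disjoint : ∀ {k} (xs : List A) → k ℕ.≤ length xs → Unique xs →
                          Disjoint (take (length xs ℕ.∸ k) xs) (take k (reverse xs))
  take-reverse-disjoint {k} xs k≤ u {x} (x∈take , x∈take-rev) =
    take∩drop=∅ (x∈take , Any.reverse⁻ (subst (x ∈_) (take-reverse xs k≤) x∈take-rev))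
    where
    m = length xs ℕ.∸ k
    take∩drop=∅ : Disjoint (take m xs) (drop m xs)
    take∩drop=∅ =
      proj₂ (proj₂ (Unique-++⁻ (take m xs) (subst Unique (≡.sym (take++drop≡id m xs)) u)))

module _ {c ℓ} (R : RealField c ℓ) where
  private
    ℝ : AlmostCommutativeRing c ℓ
    ℝ = fromCommutativeRing (RealField.commRing R) (λ _ → nothing)
  open AlmostCommutativeRing ℝ using (Carrier; _≈_; _+_; _*_)

  +-*-interchange : ∀ a x t y X Y → a * (x + t * y) + (X + t * Y) ≈ (a * x + X) + t * (a * y + Y)
  +-*-interchange = solve-∀ ℝ

module _ {c ℓ} (R : RealField c ℓ) where
  open RealField R
  open CommutativeRing commRing
    using (setoid; sym; trans; +-cong; +-congˡ; *-congˡ; -‿cong; *-comm; *-assoc; *-identityʳ;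
           zeroʳ; +-identityˡ; +-identityʳ; -‿inverseʳ; ring)
  open import Algebra.Properties.Ring ring using (-‿distribˡ-*; -‿distribʳ-*; -0#≈0#; -‿+-comm)
  open IsStrictTotalOrder <-isStrictTotalOrder using (_≟_; <-respˡ-≈; <-respʳ-≈)
  open import Relation.Binary.Reasoning.Setoid setoid
  open Arrangement R

  x+[-xz]*y≈0 : ∀ x {y z} → y * z ≈ 1# → x + (- (x * z)) * y ≈ 0#
  x+[-xz]*y≈0 x {y} {z} yz≈1 = begin
    x + (- (x * z)) * y ≈⟨ +-congˡ (-‿distribˡ-* (x * z) y) ⟨
    x + - ((x * z) * y) ≈⟨ +-congˡ (-‿cong xz*y≈x) ⟩
    x + - x             ≈⟨ -‿inverseʳ x ⟩
    0#                  ∎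
    where
    xz*y≈x : (x * z) * y ≈ x
    xz*y≈x = begin
      (x * z) * y ≈⟨ *-assoc x z y ⟩
      x * (z * y) ≈⟨ *-congˡ (trans (*-comm z y) yz≈1) ⟩
      x * 1#      ≈⟨ *-identityʳ x ⟩
      x           ∎

  0<x⇒-x<0 : ∀ {x} → 0# < x → (- x) < 0#
  0<x⇒-x<0 {x} 0<x = <-respʳ-≈ (-‿inverseʳ x) (<-respˡ-≈ (+-identityˡ (- x)) (+-mono-< (- x) 0<x))

  x<0⇒0<-x : ∀ {x} → x < 0# → 0# < (- x)
  x<0⇒0<-x {x} x<0 = <-respˡ-≈ (-‿inverseʳ x) (<-respʳ-≈ (+-identityˡ (- x)) (+-mono-< (- x) x<0))

  _+[_]·_ : ∀ {n} → Vec n → Carrier → Vec n → Vec n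
  (x +[ t ]· y) i = x i + t * y i

  negate : ∀ {n} → Vec n → Vec n
  negate x i = - x i

  dot-+· : ∀ {n} (u x : Vec n) t y → dot u (x +[ t ]· y) ≈ dot u x + t * dot u y
  dot-+· {ℕ.zero}  u x t y = sym (trans (+-congˡ (zeroʳ t)) (+-identityʳ 0#))
  dot-+· {ℕ.suc n} u x t y =
    trans (+-congˡ (dot-+· (tail u) (tail x) t (tail y))) (+-*-interchange R _ _ _ _ _ _)

  dot-negate : ∀ {n} (u x : Vec n) → dot u (negate x) ≈ - dot u x
  dot-negate {ℕ.zero}  u x = sym -0#≈0#
  dot-negate {ℕ.suc n} u x = begin
    u zero * - x zero + dot (tail u) (negate (tail x))
      ≈⟨ +-cong (sym (-‿distribʳ-* _ _)) (dot-negate (tail u) (tail x)) ⟩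
    - (u zero * x zero) + - dot (tail u) (tail x)      ≈⟨ -‿+-comm _ _ ⟩
    - dot u x                                          ∎

  project : ∀ {n} (u x₀ : Vec n) → ¬ OnHyp u x₀ → Vec n → Vec n
  project u x₀ u·x₀≉0 y = y +[ - (dot u y * proj₁ (inverse _ u·x₀≉0)) ]· x₀

  project-onHyp : ∀ {n} {u x₀ : Vec n} (u·x₀≉0 : ¬ OnHyp u x₀) y → OnHyp u (project u x₀ u·x₀≉0 y)
  project-onHyp {u = u} {x₀} u·x₀≉0 y =
    trans (dot-+· u y _ x₀) (x+[-xz]*y≈0 (dot u y) (proj₂ (inverse _ u·x₀≉0)))

  dot-project : ∀ {n} {u x₀ w : Vec n} (u·x₀≉0 : ¬ OnHyp u x₀) → OnHyp w x₀ →
                ∀ y → dot w (project u x₀ u·x₀≉0 y) ≈ dot w y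
  dot-project {u = u} {x₀} {w} u·x₀≉0 w·x₀≈0 y = begin
    dot w (project u x₀ u·x₀≉0 y) ≈⟨ dot-+· w y _ x₀ ⟩
    dot w y + t * dot w x₀        ≈⟨ +-congˡ (trans (*-congˡ w·x₀≈0) (zeroʳ t)) ⟩
    dot w y + 0#                  ≈⟨ +-identityʳ _ ⟩
    dot w y                       ∎
    where t = - (dot u y * proj₁ (inverse _ u·x₀≉0))

  ⊆-through-point : ∀ {n} {t u w x₀ : Vec n} → ¬ OnHyp u x₀ → OnHyp t x₀ → OnHyp w x₀ →
                    OnHyp t ∩ OnHyp u ⊆ OnHyp w → OnHyp t ⊆ OnHyp w
  ⊆-through-point u·x₀≉0 t·x₀≈0 w·x₀≈0 t∩u⊆w {y} t·y≈0 =
    trans (sym (dot-project u·x₀≉0 w·x₀≈0 y))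
          (t∩u⊆w (trans (dot-project u·x₀≉0 t·x₀≈0 y) t·y≈0 , project-onHyp u·x₀≉0 y))

  -- Project y into H_u along x₀.  If the projection y′ were off H_v, then H_u ⊆ H_w₁
  -- (through the point y′), and with x₀ ∈ H_w₁ ∖ H_u this forces w₁ = 0.
  OnHyp-⊆ : ∀ {n} {u v w₁ w₂ x₀ : Vec n} → (∃ λ z → ¬ OnHyp w₁ z) →
            ¬ OnHyp u x₀ → OnHyp w₁ x₀ → OnHyp w₂ x₀ →
            OnHyp u ∩ OnHyp v ⊆ OnHyp w₁ → OnHyp u ∩ OnHyp v ⊆ OnHyp w₂ → OnHyp w₁ ⊆ OnHyp w₂
  OnHyp-⊆ {u = u} {v} {w₁} {w₂} {x₀} (z , w₁·z≉0) u·x₀≉0 w₁·x₀≈0 w₂·x₀≈0 X⊆w₁ X⊆w₂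
          {y} w₁·y≈0
    with dot v y′ ≟ 0#
    where y′ = project u x₀ u·x₀≉0 y
  ... | yes v·y′≈0 =
    trans (sym (dot-project u·x₀≉0 w₂·x₀≈0 y)) (X⊆w₂ (project-onHyp u·x₀≉0 y , v·y′≈0))
  ... | no  v·y′≉0 = ⊥-elim (w₁·z≉0 w₁·z≈0)
    where
    w₁·y′≈0 : OnHyp w₁ (project u x₀ u·x₀≉0 y)
    w₁·y′≈0 = trans (dot-project u·x₀≉0 w₁·x₀≈0 y) w₁·y≈0
    u⊆w₁ : OnHyp u ⊆ OnHyp w₁
    u⊆w₁ = ⊆-through-point {t = u} {v} {w₁} v·y′≉0 (project-onHyp u·x₀≉0 y) w₁·y′≈0 X⊆w₁
    w₁·z≈0 : OnHyp w₁ z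
    w₁·z≈0 = trans (sym (dot-project u·x₀≉0 w₁·x₀≈0 z)) (u⊆w₁ (project-onHyp u·x₀≉0 z))

  OnHyp-∩-⊆ : ∀ {n} {u v w₁ w₂ : Vec n} → (∃ λ z → ¬ OnHyp w₁ z) → (∃ λ z → ¬ OnHyp w₂ z) →
              ¬ (∀ x → OnHyp w₁ x ⇔ OnHyp w₂ x) →
              OnHyp u ∩ OnHyp v ⊆ OnHyp w₁ → OnHyp u ∩ OnHyp v ⊆ OnHyp w₂ →
              OnHyp w₁ ∩ OnHyp w₂ ⊆ OnHyp u
  OnHyp-∩-⊆ {u = u} w₁≉0 w₂≉0 w₁≠w₂ X⊆w₁ X⊆w₂ {x₀} (w₁·x₀≈0 , w₂·x₀≈0) with dot u x₀ ≟ 0#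
  ... | yes u·x₀≈0 = u·x₀≈0
  ... | no  u·x₀≉0 = ⊥-elim (w₁≠w₂ λ _ → mk⇔
        (OnHyp-⊆ w₁≉0 u·x₀≉0 w₁·x₀≈0 w₂·x₀≈0 X⊆w₁ X⊆w₂)
        (OnHyp-⊆ w₂≉0 u·x₀≉0 w₂·x₀≈0 w₁·x₀≈0 X⊆w₂ X⊆w₁))

  module _ {n N : ℕ} (𝒜 : CentralArrangement n N) where
    open CentralArrangement 𝒜

    Contains-of-two : ∀ {a b h₁ h₂ k} → h₁ ≢ h₂ →
                      Contains 𝒜 a b h₁ → Contains 𝒜 a b h₂ → Contains 𝒜 a b k → Contains 𝒜 h₁ h₂ k
    Contains-of-two {a} {b} {h₁} {h₂} h₁≢h₂ C₁ C₂ Cₖ x h₁·x≈0 h₂·x≈0 =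
      Cₖ x (H₁∩H₂⊆ (λ (a·y≈0 , b·y≈0) → C₁ _ a·y≈0 b·y≈0) (λ (a·y≈0 , b·y≈0) → C₂ _ a·y≈0 b·y≈0))
           (H₁∩H₂⊆ (λ (b·y≈0 , a·y≈0) → C₁ _ a·y≈0 b·y≈0) (λ (b·y≈0 , a·y≈0) → C₂ _ a·y≈0 b·y≈0))
      where
      H₁∩H₂⊆ : ∀ {u v} → OnHyp u ∩ OnHyp v ⊆ OnHyp (α h₁) → OnHyp u ∩ OnHyp v ⊆ OnHyp (α h₂) → OnHyp u x
      H₁∩H₂⊆ X⊆H₁ X⊆H₂ =
        OnHyp-∩-⊆ (nonzero h₁) (nonzero h₂) (distinct h₁ h₂ h₁≢h₂) X⊆H₁ X⊆H₂ (h₁·x≈0 , h₂·x≈0)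

    reverse≡⊎Contains-⊆ : ∀ {a b a′ b′} {hs : List (Fin N)} → Unique hs →
                          All (Contains 𝒜 a b) hs → All (Contains 𝒜 a′ b′) hs →
                          reverse hs ≡ hs ⊎ (∀ {k} → Contains 𝒜 a′ b′ k → Contains 𝒜 a b k)
    reverse≡⊎Contains-⊆ {hs = []}         _ _ _ = inj₁ refl
    reverse≡⊎Contains-⊆ {hs = _ ∷ []}     _ _ _ = inj₁ refl
    reverse≡⊎Contains-⊆ {hs = _ ∷ _ ∷ _} (h₁∉ ∷ _) (C₁ ∷ C₂ ∷ _) (C′₁ ∷ C′₂ ∷ _) =
      inj₂ λ C′ₖ x a·x≈0 b·x≈0 →
        Contains-of-two (All.head h₁∉) C′₁ C′₂ C′ₖ x (C₁ x a·x≈0 b·x≈0) (C₂ x a·x≈0 b·x≈0)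

    SameSide⇒OppSide-negate : ∀ {h x p} → SameSide 𝒜 h x p → OppSide 𝒜 h (negate x) p
    SameSide⇒OppSide-negate {h} {x} (inj₁ (0<h·x , 0<h·p)) =
      inj₂ (<-respˡ-≈ (sym (dot-negate (α h) x)) (0<x⇒-x<0 0<h·x) , 0<h·p)
    SameSide⇒OppSide-negate {h} {x} (inj₂ (h·x<0 , h·p<0)) =
      inj₁ (<-respʳ-≈ (sym (dot-negate (α h) x)) (x<0⇒0<-x h·x<0) , h·p<0)

    OppSide⇒SameSide-negate : ∀ {h x p} → OppSide 𝒜 h x p → SameSide 𝒜 h (negate x) p
    OppSide⇒SameSide-negate {h} {x} (inj₁ (0<h·x , h·p<0)) =
      inj₂ (<-respˡ-≈ (sym (dot-negate (α h) x)) (0<x⇒-x<0 0<h·x) , h·p<0)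
    OppSide⇒SameSide-negate {h} {x} (inj₂ (h·x<0 , 0<h·p)) =
      inj₁ (<-respʳ-≈ (sym (dot-negate (α h) x)) (x<0⇒0<-x h·x<0) , 0<h·p)

    GalleryChamberExists-reverse : ∀ {p₀ a b G k} → Unique G → (∀ h → Contains 𝒜 a b h → h ∈ G) →
                                   k ℕ.≤ length G → GalleryChamberExists 𝒜 p₀ a b G (length G ℕ.∸ k) →
                                   GalleryChamberExists 𝒜 p₀ a b (reverse G) k
    GalleryChamberExists-reverse {G = G} uG cover k≤ (x , sides) =
      negate x , λ h C →
        (λ h∈rev → SameSide⇒OppSide-negate (proj₂ (sides h C) λ h∈take →
                     take-reverse-disjoint G k≤ uG (h∈take , h∈rev))) ,
        (λ h∉rev → OppSide⇒SameSide-negate (proj₁ (sides h C)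
                     (fromInj₁ (⊥-elim ∘′ h∉rev) (∈-take⊎∈-take-reverse G k≤ (cover h C)))))

    ReducedGalleryOrder-reverse : ∀ {p₀ a b G} → ReducedGalleryOrder 𝒜 p₀ a b G →
                                  ReducedGalleryOrder 𝒜 p₀ a b (reverse G)
    ReducedGalleryOrder-reverse {G = G} (all-C , uG , cover , chambers) =
      All-resp-↭ (↭-sym (↭-reverse G)) all-C ,
      Unique-resp-↭ (↭-sym (↭-reverse G)) uG ,
      (λ h C → Any.reverse⁺ (cover h C)) ,
      λ k k≤ → GalleryChamberExists-reverse uG cover (≤-reverse k≤)
                 (chambers _ (m∸n≤m (length G) k))
      where
      ≤-reverse : ∀ {k} → k ℕ.≤ length (reverse G) → k ℕ.≤ length G
      ≤-reverse = subst (_ ℕ.≤_) (length-reverse G)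

    ReducedGalleryOrder-reverse-++[] : ∀ {p₀ a b} G → ReducedGalleryOrder 𝒜 p₀ a b (G ++ []) →
                                       ReducedGalleryOrder 𝒜 p₀ a b (reverse G ++ [])
    ReducedGalleryOrder-reverse-++[] {p₀} {a} {b} G =
      subst (ReducedGalleryOrder 𝒜 p₀ a b) (≡.sym (++-identityʳ (reverse G))) ∘′
      ReducedGalleryOrder-reverse ∘′
      subst (ReducedGalleryOrder 𝒜 p₀ a b) (++-identityʳ G)

    module _ {p} {Q : Fin N → Set p} where

      Restrict-++⁻ : ∀ xs {ys G} → Restrict 𝒜 Q (xs ++ ys) G →
                     ∃₂ λ G₁ G₂ → G ≡ G₁ ++ G₂ × Restrict 𝒜 Q xs G₁ × Restrict 𝒜 Q ys G₂
      Restrict-++⁻ []       r = [] , _ , refl , [] , r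
      Restrict-++⁻ (x ∷ xs) (keep q r) with Restrict-++⁻ xs r
      ... | G₁ , G₂ , refl , r₁ , r₂ = x ∷ G₁ , G₂ , refl , keep q r₁ , r₂
      Restrict-++⁻ (x ∷ xs) (skip q r) with Restrict-++⁻ xs r
      ... | G₁ , G₂ , refl , r₁ , r₂ = G₁ , G₂ , refl , skip q r₁ , r₂

      Restrict-++⁺ : ∀ {xs ys G₁ G₂} → Restrict 𝒜 Q xs G₁ → Restrict 𝒜 Q ys G₂ →
                     Restrict 𝒜 Q (xs ++ ys) (G₁ ++ G₂)
      Restrict-++⁺ []         r₂ = r₂
      Restrict-++⁺ (keep q r) r₂ = keep q (Restrict-++⁺ r r₂)
      Restrict-++⁺ (skip q r) r₂ = skip q (Restrict-++⁺ r r₂)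

      Restrict-reverse : ∀ {xs G} → Restrict 𝒜 Q xs G → Restrict 𝒜 Q (reverse xs) (reverse G)
      Restrict-reverse [] = []
      Restrict-reverse (keep {x} {xs} {G} q r) =
        subst₂ (Restrict 𝒜 Q) (≡.sym (unfold-reverse x xs)) (≡.sym (unfold-reverse x G))
               (Restrict-++⁺ (Restrict-reverse r) (keep q []))
      Restrict-reverse (skip {x} {xs} {G} q r) =
        subst₂ (Restrict 𝒜 Q) (≡.sym (unfold-reverse x xs)) (++-identityʳ (reverse G))
               (Restrict-++⁺ (Restrict-reverse r) (skip q []))

      Restrict-⊆ : ∀ {xs G g} → Restrict 𝒜 Q xs G → g ∈ G → g ∈ xs
      Restrict-⊆ (keep q r) (here refl) = here refl
      Restrict-⊆ (keep q r) (there g∈G) = there (Restrict-⊆ r g∈G)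
      Restrict-⊆ (skip q r) g∈G         = there (Restrict-⊆ r g∈G)

      Restrict⇒All : ∀ {xs G} → Restrict 𝒜 Q xs G → All Q G
      Restrict⇒All []         = []
      Restrict⇒All (keep q r) = q ∷ Restrict⇒All r
      Restrict⇒All (skip q r) = Restrict⇒All r

      Restrict-none : ∀ {xs G} → (∀ {g} → g ∈ xs → ¬ Q g) → Restrict 𝒜 Q xs G → G ≡ []
      Restrict-none ∉Q []         = refl
      Restrict-none ∉Q (keep q r) = ⊥-elim (∉Q (here refl) q)
      Restrict-none ∉Q (skip q r) = Restrict-none (∉Q ∘′ there) r

    module _ {a b : Fin N} (P M S : List (Fin N)) (uL : Unique (P ++ M ++ S))
             (M⇔X : ∀ k → (k ∈ M) ⇔ Contains 𝒜 a b k) where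

      private
        P∩M=∅ : Disjoint P M
        P∩M=∅ (v∈P , v∈M) = proj₂ (proj₂ (Unique-++⁻ P uL)) (v∈P , ∈-++⁺ˡ v∈M)

        M∩S=∅ : Disjoint M S
        M∩S=∅ = proj₂ (proj₂ (Unique-++⁻ M (proj₁ (proj₂ (Unique-++⁻ P uL)))))

      ReducedGalleryOrder-reverse-block :
        ∀ {p₀ a′ b′ GP GM GS} → let Q = Contains 𝒜 a′ b′ in
        Restrict 𝒜 Q P GP → Restrict 𝒜 Q M GM → Restrict 𝒜 Q S GS →
        ReducedGalleryOrder 𝒜 p₀ a′ b′ (GP ++ GM ++ GS) →
        ReducedGalleryOrder 𝒜 p₀ a′ b′ (GP ++ reverse GM ++ GS)
      ReducedGalleryOrder-reverse-block {p₀} {a′} {b′} {GP} {GM} {GS} rP rM rS rgo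
        with reverse≡⊎Contains-⊆ (Unique-middle GP (proj₁ (proj₂ rgo)))
               (All.tabulate (λ g∈GM → Equivalence.to (M⇔X _) (Restrict-⊆ rM g∈GM))) (Restrict⇒All rM)
      ... | inj₁ rev≡ =
        subst (λ hs → ReducedGalleryOrder 𝒜 p₀ a′ b′ (GP ++ hs ++ GS)) (≡.sym rev≡) rgo
      ... | inj₂ X′⊆X
        with Restrict-none (λ g∈P Qg → P∩M=∅ (g∈P , Equivalence.from (M⇔X _) (X′⊆X Qg))) rP
           | Restrict-none (λ g∈S Qg → M∩S=∅ (Equivalence.from (M⇔X _) (X′⊆X Qg) , g∈S)) rS
      ...   | refl | refl = ReducedGalleryOrder-reverse-++[] GM rgo

      Admissible-reverse-block : ∀ {p₀} → Admissible 𝒜 p₀ (P ++ M ++ S) →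
                                 Admissible 𝒜 p₀ (P ++ reverse M ++ S)
      Admissible-reverse-block adm a′ b′ a′≢b′ with adm a′ b′ a′≢b′
      ... | G , r , rgo with Restrict-++⁻ P r
      ... | GP , _ , refl , rP , r′ with Restrict-++⁻ M r′
      ... | GM , GS , refl , rM , rS =
        GP ++ reverse GM ++ GS ,
        Restrict-++⁺ rP (Restrict-++⁺ (Restrict-reverse rM) rS) ,
        ReducedGalleryOrder-reverse-block rP rM rS rgo

lemma4p4 : ∀ {c ℓ : Level} (R : RealField c ℓ) (n N : ℕ)
    (𝒜 : Arrangement.CentralArrangement R n N)
    (p₀ : Arrangement.Vec R n) → Arrangement.Generic R 𝒜 p₀ →
    (L : List (Fin N)) → L ↭ allFin N → Arrangement.Admissible R 𝒜 p₀ L →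
    (a b : Fin N) → a ≢ b →
    (P M S : List (Fin N)) → L ≡ P ++ M ++ S →
    (∀ k → (k ∈ M) ⇔ Arrangement.Contains R 𝒜 a b k) →
    ((P ++ reverse M ++ S) ↭ allFin N) × Arrangement.Admissible R 𝒜 p₀ (P ++ reverse M ++ S)
lemma4p4 R n N 𝒜 p₀ _ L L↭allFin adm a b _ P M S refl M⇔X =
  ↭-trans (++⁺ˡ P (++⁺ʳ S (↭-reverse M))) L↭allFin ,
  Admissible-reverse-block R 𝒜 P M S (Unique-resp-↭ (↭-sym L↭allFin) (allFin⁺ N)) M⇔X adm
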